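{- Let $0\le t\le n$ be integers. For every $0\le r\le t$, $T_{n,t}\phi_r^{(t)}=\lambda_{n,t,r}\,\phi_r^{(n)}$.
   Context: Falling factorial: $x^{\underline\ell}=x(x-1)\cdots(x-\ell+1)$, $x^{\underline0}=1$. For $0\le r\le m$, the Hahn polynomial is $Q_r^{(m)}(x):=\sum_{\ell=0}^r(-1)^\ell\binom r\ell\binom{r+\ell}{\ell}\frac{x^{\underline\ell}}{m^{\underline\ell}}$, and $H_{m,r}:=\frac{1}{2r+1}\prod_{j=0}^{r-1}\frac{m+j+2}{m-j}$ (which equals $\frac1{m+1}\sum_{x=0}^mQ_r^{(m)}(x)^2$). The orthonormal Hahn polynomial is $\phi_r^{(m)}:=Q_r^{(m)}/\sqrt{H_{m,r}}$, viewed as a function on $\{0,\dots,m\}$. For $0\le r\le t\le n$, $\lambda_{n,t,r}:=\sqrt{H_{n,r}/H_{t,r}}$. For $f:\{0,\dots,t\}\to\mathbb R$, the hypergeometric sampling operator gives $T_{n,t}f:\{0,\dots,n\}\to\mathbb R$, $(T_{n,t}f)(k):=\sum_{a=0}^t f(a)\binom ka\binom{n-k}{t-a}/\binom nt$ (binomial coefficients with out-of-range arguments are $0$); equivalently $(T_{n,t}f)(k)=\mathbb E[f(|S\cap W|)]$ for a fixed $k$-set $W\subseteq[n]$ and uniformly random $t$-subset $S\subseteq[n]$. -}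

module Defs where

open import Data.Nat as ℕ using (ℕ; zero; suc; _∸_)
open import Data.Nat.Combinatorics using (_C_)
open import Data.Integer using (+_)
open import Data.Rational using (ℚ; 0ℚ; 1ℚ; _+_; _*_; -_)
import Data.Rational as ℚ

fall : ℕ → ℕ → ℕ
fall x zero    = 1
fall x (suc l) = fall x l ℕ.* (x ∸ l)

-- a / b as a rational (b = 0 never occurs in uses below; convention a/0 = 0)
divℕ : ℕ → ℕ → ℚ
divℕ a zero    = 0ℚ
divℕ a (suc b) = (+ a) ℚ./ suc b

sgn : ℕ → ℚ
sgn zero    = 1ℚ
sgn (suc l) = - sgn l

sumTo : ℕ → (ℕ → ℚ) → ℚ
sumTo zero    f = f 0
sumTo (suc r) f = sumTo r f + f (suc r)

-- Hahn polynomial Q_r^{(m)}(x) = Σ_{l=0}^r (-1)^l C(r,l) C(r+l,l) x^{\underline l}/m^{\underline l}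
hahnQ : (m r : ℕ) → ℕ → ℚ
hahnQ m r x = sumTo r (λ l →
  sgn l * ((+ ((r C l) ℕ.* ((r ℕ.+ l) C l))) ℚ./ 1) * divℕ (fall x l) (fall m l))

-- hypergeometric sampling operator
-- (T_{n,t} f)(k) = Σ_{a=0}^t f(a) C(k,a) C(n-k,t-a) / C(n,t)   (used for k ≤ n)
T : (n t : ℕ) → (ℕ → ℚ) → ℕ → ℚ
T n t f k = sumTo t (λ a → f a * divℕ ((k C a) ℕ.* ((n ∸ k) C (t ∸ a))) (n C t))

{-# OPTIONS --safe #-}
module Submission where

-- Q_r^(t) and Q_r^(n) are combinations of the normalised falling factorials
-- x^(l)/m^(l) (m = t, resp. n) with the same coefficients, so by linearity of T it
-- suffices that T maps a^(l)/t^(l) to k^(l)/n^(l). This is the factorial-moment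
-- identity E[X^(l)] = k^(l) t^(l) / n^(l) for the hypergeometric X = |S ∩ W|, proved
-- in ℕ by induction on l: the absorption identity (a+1) C(k+1,a+1) = (k+1) C(k,a)
-- lowers the order of the moment, and Vandermonde's identity is the base case.

open import Defs
open import Data.Nat using (ℕ; _≤_)
open import Relation.Binary.PropositionalEquality using (_≡_)

open import Algebra.Bundles using (CommutativeMonoid)
open import Data.Fin using (Fin; toℕ)
open import Data.Nat as ℕ using (zero; suc; _∸_; NonZero)
import Data.Nat.Properties as ℕ
open import Data.Nat.Combinatorics using (_C_)
open import Data.Nat.Tactic.RingSolver using (solve-∀)
open import Data.Rational as ℚ using (ℚ)
import Data.Rational.Unnormalised as ℚᵘ
import Data.Rational.Unnormalised.Properties as ℚᵘ
open import Algebra.Properties.Semiring.Sum ℕ.+-*-semiring using (sum⁺-syntax)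
open import Function using (_∘_)
open import Relation.Binary.PropositionalEquality
  using (refl; sym; trans; cong; cong₂; subst; module ≡-Reasoning)
open ≡-Reasoning

module _ where
  open import Data.Nat using (_+_; _*_; s≤s; z≤n; >-nonZero; >-nonZero⁻¹)
  open import Data.Nat.Properties
  open import Data.Nat.Combinatorics using (nCk+nC[k+1]≡[n+1]C[k+1]; nC1≡n; k>n⇒nCk≡0)
  open import Algebra.Properties.Semiring.Sum +-*-semiring
    using (sum-cong-≗; sum-replicate-zero; ∑-distrib-+; *-distribˡ-sum)

  -- _C_ is infixl 6.5: it binds more loosely than _*_.

  vandermonde : ∀ k m t → ∑[ i ≤ t ] ((k C toℕ i) * (m C (t ∸ toℕ i))) ≡ (k + m) C t
  vandermonde zero    m zero    = refl
  vandermonde zero    m (suc t) = begin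
    1 * (m C suc t) + ∑[ i ≤ t ] 0
      ≡⟨ cong₂ _+_ (*-identityˡ (m C suc t)) (sum-replicate-zero (suc t)) ⟩
    m C suc t + 0
      ≡⟨ +-identityʳ (m C suc t) ⟩
    m C suc t ∎
  vandermonde (suc k) m zero    = refl
  vandermonde (suc k) m (suc t) = begin
    1 * (m C suc t) + ∑[ i ≤ t ] ((suc k C suc (toℕ i)) * (m C (t ∸ toℕ i)))
      ≡⟨ cong₂ _+_ (*-identityˡ (m C suc t)) (sum-cong-≗ {suc t} pascal) ⟩
    m C suc t + ∑[ i ≤ t ] (A i + B i)
      ≡⟨ cong (m C suc t +_) (∑-distrib-+ {suc t} A B) ⟩
    m C suc t + (∑[ i ≤ t ] A i + ∑[ i ≤ t ] B i)
      ≡⟨ x+[y+z]≡y+[x+z] (m C suc t) (∑[ i ≤ t ] A i) (∑[ i ≤ t ] B i) ⟩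
    ∑[ i ≤ t ] A i + (m C suc t + ∑[ i ≤ t ] B i)
      ≡⟨ cong₂ (λ u v → u + (v + ∑[ i ≤ t ] B i)) (vandermonde k m t) (sym (*-identityˡ (m C suc t))) ⟩
    (k + m) C t + ∑[ i ≤ suc t ] ((k C toℕ i) * (m C (suc t ∸ toℕ i)))
      ≡⟨ cong ((k + m) C t +_) (vandermonde k m (suc t)) ⟩
    (k + m) C t + (k + m) C suc t
      ≡⟨ nCk+nC[k+1]≡[n+1]C[k+1] (k + m) t ⟩
    suc (k + m) C suc t ∎
    where
    A B : Fin (suc t) → ℕ
    A i = (k C toℕ i) * (m C (t ∸ toℕ i))
    B i = (k C suc (toℕ i)) * (m C (t ∸ toℕ i))
    pascal : ∀ i → (suc k C suc (toℕ i)) * (m C (t ∸ toℕ i)) ≡ A i + B i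
    pascal i = trans (cong (_* (m C (t ∸ toℕ i))) (sym (nCk+nC[k+1]≡[n+1]C[k+1] k (toℕ i))))
                     (*-distribʳ-+ (m C (t ∸ toℕ i)) (k C toℕ i) (k C suc (toℕ i)))
    x+[y+z]≡y+[x+z] : ∀ x y z → x + (y + z) ≡ y + (x + z)
    x+[y+z]≡y+[x+z] = solve-∀

  [k+1]*[n+1]C[k+1]≡[n+1]*nCk : ∀ n k → suc k * (suc n C suc k) ≡ suc n * (n C k)
  [k+1]*[n+1]C[k+1]≡[n+1]*nCk zero    zero    = refl
  [k+1]*[n+1]C[k+1]≡[n+1]*nCk zero    (suc k) =
    trans (cong (suc (suc k) *_) (k>n⇒nCk≡0 (s≤s (s≤s (z≤n {k}))))) (*-zeroʳ (suc (suc k)))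
  [k+1]*[n+1]C[k+1]≡[n+1]*nCk (suc n) zero    =
    trans (*-identityˡ (suc (suc n) C 1)) (trans (nC1≡n (suc (suc n))) (sym (*-identityʳ (suc (suc n)))))
  [k+1]*[n+1]C[k+1]≡[n+1]*nCk (suc n) (suc k) = begin
    suc (suc k) * (suc (suc n) C suc (suc k))
      ≡⟨ cong (suc (suc k) *_) (sym (nCk+nC[k+1]≡[n+1]C[k+1] (suc n) (suc k))) ⟩
    suc (suc k) * (x + y)
      ≡⟨ split (suc k) x y ⟩
    suc k * x + x + suc (suc k) * y
      ≡⟨ cong₂ (λ u v → u + x + v) ([k+1]*[n+1]C[k+1]≡[n+1]*nCk n k)
                                   ([k+1]*[n+1]C[k+1]≡[n+1]*nCk n (suc k)) ⟩
    suc n * (n C k) + x + suc n * (n C suc k)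
      ≡⟨ merge (suc n) (n C k) x (n C suc k) ⟩
    suc n * ((n C k) + (n C suc k)) + x
      ≡⟨ cong (λ u → suc n * u + x) (nCk+nC[k+1]≡[n+1]C[k+1] n k) ⟩
    suc n * x + x
      ≡⟨ +-comm (suc n * x) x ⟩
    suc (suc n) * x ∎
    where
    x y : ℕ
    x = suc n C suc k
    y = suc n C suc (suc k)
    split : ∀ a x y → suc a * (x + y) ≡ a * x + x + suc a * y
    split = solve-∀
    merge : ∀ a b x c → a * b + x + a * c ≡ a * (b + c) + x
    merge = solve-∀

  fall-suc-suc : ∀ x l → fall (suc x) (suc l) ≡ suc x * fall x l
  fall-suc-suc x zero    = trans (*-identityˡ (suc x)) (sym (*-identityʳ (suc x)))
  fall-suc-suc x (suc l) =
    trans (cong (_* (x ∸ l)) (fall-suc-suc x l)) (*-assoc (suc x) (fall x l) (x ∸ l))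

  fall-zero-suc : ∀ l → fall 0 (suc l) ≡ 0
  fall-zero-suc l = trans (cong (fall 0 l *_) (0∸n≡0 l)) (*-zeroʳ (fall 0 l))

  fall≢0 : ∀ {x l} → l ≤ x → NonZero (fall x l)
  fall≢0 {l = zero}  _   = _
  fall≢0 {x} {suc l} l<x =
    m*n≢0 (fall x l) (x ∸ l) {{fall≢0 (<⇒≤ l<x)}} {{>-nonZero (m<n⇒0<n∸m l<x)}}

  nCk≢0 : ∀ {n k} → k ≤ n → NonZero (n C k)
  nCk≢0 {k = zero}          _         = _
  nCk≢0 {suc n} {suc k} (s≤s k≤n) =
    subst NonZero (nCk+nC[k+1]≡[n+1]C[k+1] n k)
          (>-nonZero (≤-trans (>-nonZero⁻¹ (n C k) {{nCk≢0 k≤n}}) (m≤m+n (n C k) (n C suc k))))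

  -- C(k+m,t) times the l-th factorial moment E[X(X-1)⋯(X-l+1)] of the hypergeometric
  -- X = |S ∩ W| with |W| = k, |S| = t, in a ground set of size k + m.
  factorialMoment : (l k m t : ℕ) → ℕ
  factorialMoment l k m t = ∑[ i ≤ t ] (fall (toℕ i) l * ((k C toℕ i) * (m C (t ∸ toℕ i))))

  zeroth-factorialMoment : ∀ k m t → factorialMoment 0 k m t ≡ (k + m) C t
  zeroth-factorialMoment k m t =
    trans (sum-cong-≗ {suc t} (λ i → *-identityˡ ((k C toℕ i) * (m C (t ∸ toℕ i)))))
          (vandermonde k m t)

  factorialMoment-of-empty : ∀ l m t → factorialMoment (suc l) 0 m t ≡ 0
  factorialMoment-of-empty l m zero    = cong (λ u → u * (m C 0) + 0) (fall-zero-suc l)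
  factorialMoment-of-empty l m (suc t) = begin
    fall 0 (suc l) * (1 * (m C suc t)) + ∑[ i ≤ t ] (fall (suc (toℕ i)) (suc l) * 0)
      ≡⟨ cong₂ (λ u v → u * (1 * (m C suc t)) + v) (fall-zero-suc l)
               (sum-cong-≗ {suc t} (λ i → *-zeroʳ (fall (suc (toℕ i)) (suc l)))) ⟩
    ∑[ i ≤ t ] 0
      ≡⟨ sum-replicate-zero (suc t) ⟩
    0 ∎

  factorialMoment-suc : ∀ l k m t →
    factorialMoment (suc l) (suc k) m (suc t) ≡ suc k * factorialMoment l k m t
  factorialMoment-suc l k m t = begin
    fall 0 (suc l) * (1 * (m C suc t))
      + ∑[ i ≤ t ] (fall (suc (toℕ i)) (suc l) * ((suc k C suc (toℕ i)) * (m C (t ∸ toℕ i))))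
      ≡⟨ cong₂ (λ u v → u * (1 * (m C suc t)) + v)
               (fall-zero-suc l) (sum-cong-≗ {suc t} (absorb ∘ toℕ)) ⟩
    ∑[ i ≤ t ] (suc k * term (toℕ i))
      ≡⟨ *-distribˡ-sum {suc t} (suc k) (term ∘ toℕ) ⟨
    suc k * factorialMoment l k m t ∎
    where
    term : ℕ → ℕ
    term a = fall a l * ((k C a) * (m C (t ∸ a)))
    absorb : ∀ a → fall (suc a) (suc l) * ((suc k C suc a) * (m C (t ∸ a))) ≡ suc k * term a
    absorb a = begin
      fall (suc a) (suc l) * ((suc k C suc a) * (m C (t ∸ a)))
        ≡⟨ cong (_* ((suc k C suc a) * (m C (t ∸ a)))) (fall-suc-suc a l) ⟩
      suc a * fall a l * ((suc k C suc a) * (m C (t ∸ a)))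
        ≡⟨ regroup (suc a) (fall a l) (suc k C suc a) (m C (t ∸ a)) ⟩
      fall a l * ((suc a * (suc k C suc a)) * (m C (t ∸ a)))
        ≡⟨ cong (λ u → fall a l * (u * (m C (t ∸ a)))) ([k+1]*[n+1]C[k+1]≡[n+1]*nCk k a) ⟩
      fall a l * ((suc k * (k C a)) * (m C (t ∸ a)))
        ≡⟨ pull (fall a l) (suc k) (k C a) (m C (t ∸ a)) ⟩
      suc k * term a ∎
      where
      regroup : ∀ a f c y → a * f * (c * y) ≡ f * ((a * c) * y)
      regroup = solve-∀
      pull : ∀ f b c y → f * ((b * c) * y) ≡ b * (f * (c * y))
      pull = solve-∀

  factorialMoment-*-fall : ∀ l k m t →
    factorialMoment l k m t * fall (k + m) l ≡ fall k l * (fall t l * ((k + m) C t))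
  factorialMoment-*-fall zero k m t = begin
    factorialMoment 0 k m t * 1 ≡⟨ *-identityʳ (factorialMoment 0 k m t) ⟩
    factorialMoment 0 k m t     ≡⟨ zeroth-factorialMoment k m t ⟩
    (k + m) C t                 ≡⟨ trans (*-identityˡ _) (*-identityˡ _) ⟨
    1 * (1 * ((k + m) C t))     ∎
  factorialMoment-*-fall (suc l) zero m t =
    trans (cong (_* fall m (suc l)) (factorialMoment-of-empty l m t))
          (cong (_* (fall t (suc l) * (m C t))) (sym (fall-zero-suc l)))
  factorialMoment-*-fall (suc l) (suc k) m zero =
    trans (cong (λ u → (u * 1 + 0) * fall (suc k + m) (suc l)) (fall-zero-suc l))
          (sym (trans (cong (λ u → fall (suc k) (suc l) * (u * 1)) (fall-zero-suc l))
                      (*-zeroʳ (fall (suc k) (suc l)))))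
  factorialMoment-*-fall (suc l) (suc k) m (suc t) = begin
    factorialMoment (suc l) (suc k) m (suc t) * fall (suc (k + m)) (suc l)
      ≡⟨ cong₂ _*_ (factorialMoment-suc l k m t) (fall-suc-suc (k + m) l) ⟩
    suc k * M * (suc (k + m) * fall (k + m) l)
      ≡⟨ regroup (suc k) M (suc (k + m)) (fall (k + m) l) ⟩
    suc k * suc (k + m) * (M * fall (k + m) l)
      ≡⟨ cong (suc k * suc (k + m) *_) (factorialMoment-*-fall l k m t) ⟩
    suc k * suc (k + m) * (fall k l * (fall t l * ((k + m) C t)))
      ≡⟨ regroup′ (suc k) (suc (k + m)) (fall k l) (fall t l) ((k + m) C t) ⟩
    suc k * fall k l * (fall t l * (suc (k + m) * ((k + m) C t)))
      ≡⟨ cong (λ u → suc k * fall k l * (fall t l * u)) ([k+1]*[n+1]C[k+1]≡[n+1]*nCk (k + m) t) ⟨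
    suc k * fall k l * (fall t l * (suc t * (suc (k + m) C suc t)))
      ≡⟨ cong (suc k * fall k l *_) (x[yz]≡yx·z (fall t l) (suc t) (suc (k + m) C suc t)) ⟩
    suc k * fall k l * (suc t * fall t l * (suc (k + m) C suc t))
      ≡⟨ cong₂ (λ u v → u * (v * (suc (k + m) C suc t))) (fall-suc-suc k l) (fall-suc-suc t l) ⟨
    fall (suc k) (suc l) * (fall (suc t) (suc l) * (suc (k + m) C suc t)) ∎
    where
    M : ℕ
    M = factorialMoment l k m t
    regroup : ∀ a x b y → a * x * (b * y) ≡ a * b * (x * y)
    regroup = solve-∀
    regroup′ : ∀ a b x y z → a * b * (x * (y * z)) ≡ a * x * (y * (b * z))
    regroup′ = solve-∀
    x[yz]≡yx·z : ∀ x y z → x * (y * z) ≡ y * x * z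
    x[yz]≡yx·z = solve-∀

module _ where
  open import Data.Integer using (+_)
  import Data.Integer as ℤ
  open import Data.Integer.Properties using (pos-*; pos-+)
  open import Data.Rational using (_+_; _*_; fromℚᵘ; toℚᵘ)
  open import Data.Rational.Properties
    using (fromℚᵘ-toℚᵘ; toℚᵘ-fromℚᵘ; fromℚᵘ-cong; toℚᵘ-homo-+; toℚᵘ-homo-*; +-0-commutativeMonoid;
           +-assoc; *-assoc; *-zeroˡ; *-zeroʳ; *-distribˡ-+; *-distribʳ-+)
  open import Algebra.Properties.CommutativeSemigroup
    (CommutativeMonoid.commutativeSemigroup +-0-commutativeMonoid) using (interchange)

  fromℚᵘ-homo-+ : ∀ p q → fromℚᵘ (p ℚᵘ.+ q) ≡ fromℚᵘ p + fromℚᵘ q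
  fromℚᵘ-homo-+ p q = begin
    fromℚᵘ (p ℚᵘ.+ q)
      ≡⟨ fromℚᵘ-cong (ℚᵘ.+-cong (ℚᵘ.≃-sym (toℚᵘ-fromℚᵘ p)) (ℚᵘ.≃-sym (toℚᵘ-fromℚᵘ q))) ⟩
    fromℚᵘ (toℚᵘ (fromℚᵘ p) ℚᵘ.+ toℚᵘ (fromℚᵘ q))
      ≡⟨ fromℚᵘ-cong (toℚᵘ-homo-+ (fromℚᵘ p) (fromℚᵘ q)) ⟨
    fromℚᵘ (toℚᵘ (fromℚᵘ p + fromℚᵘ q))
      ≡⟨ fromℚᵘ-toℚᵘ (fromℚᵘ p + fromℚᵘ q) ⟩
    fromℚᵘ p + fromℚᵘ q ∎

  fromℚᵘ-homo-* : ∀ p q → fromℚᵘ (p ℚᵘ.* q) ≡ fromℚᵘ p * fromℚᵘ q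
  fromℚᵘ-homo-* p q = begin
    fromℚᵘ (p ℚᵘ.* q)
      ≡⟨ fromℚᵘ-cong (ℚᵘ.*-cong (ℚᵘ.≃-sym (toℚᵘ-fromℚᵘ p)) (ℚᵘ.≃-sym (toℚᵘ-fromℚᵘ q))) ⟩
    fromℚᵘ (toℚᵘ (fromℚᵘ p) ℚᵘ.* toℚᵘ (fromℚᵘ q))
      ≡⟨ fromℚᵘ-cong (toℚᵘ-homo-* (fromℚᵘ p) (fromℚᵘ q)) ⟨
    fromℚᵘ (toℚᵘ (fromℚᵘ p * fromℚᵘ q))
      ≡⟨ fromℚᵘ-toℚᵘ (fromℚᵘ p * fromℚᵘ q) ⟩
    fromℚᵘ p * fromℚᵘ q ∎

  divℕ-cross : ∀ {a b c d} .{{_ : NonZero b}} .{{_ : NonZero d}} →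
               a ℕ.* d ≡ c ℕ.* b → divℕ a b ≡ divℕ c d
  divℕ-cross {a} {suc b} {c} {suc d} eq = fromℚᵘ-cong {ℚᵘ.mkℚᵘ (+ a) b} {ℚᵘ.mkℚᵘ (+ c) d}
    (ℚᵘ.*≡* (trans (sym (pos-* a (suc d))) (trans (cong +_ eq) (pos-* c (suc b)))))

  divℕ-*-divℕ : ∀ a b c d → divℕ a b * divℕ c d ≡ divℕ (a ℕ.* c) (b ℕ.* d)
  divℕ-*-divℕ a zero    c d       = *-zeroˡ (divℕ c d)
  divℕ-*-divℕ a (suc b) c zero    =
    trans (*-zeroʳ (divℕ a (suc b))) (cong (divℕ (a ℕ.* c)) (sym (ℕ.*-zeroʳ (suc b))))
  divℕ-*-divℕ a (suc b) c (suc d) =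
    trans (sym (fromℚᵘ-homo-* (ℚᵘ.mkℚᵘ (+ a) b) (ℚᵘ.mkℚᵘ (+ c) d)))
          (cong (λ z → fromℚᵘ (z ℚᵘ./ (suc b ℕ.* suc d))) (sym (pos-* a c)))

  divℕ-+-divℕ : ∀ a c d → divℕ a d + divℕ c d ≡ divℕ (a ℕ.+ c) d
  divℕ-+-divℕ a c zero        = refl
  divℕ-+-divℕ a c d@(suc d-1) = begin
    divℕ a d + divℕ c d
      ≡⟨ fromℚᵘ-homo-+ (ℚᵘ.mkℚᵘ (+ a) d-1) (ℚᵘ.mkℚᵘ (+ c) d-1) ⟨
    fromℚᵘ ((+ a ℤ.* + d ℤ.+ + c ℤ.* + d) ℚᵘ./ (d ℕ.* d))
      ≡⟨ cong (λ z → fromℚᵘ (z ℚᵘ./ (d ℕ.* d))) numerator ⟩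
    divℕ (a ℕ.* d ℕ.+ c ℕ.* d) (d ℕ.* d)
      ≡⟨ divℕ-cross {a ℕ.* d ℕ.+ c ℕ.* d} {d ℕ.* d} {a ℕ.+ c} {d} (cross a c d) ⟩
    divℕ (a ℕ.+ c) d ∎
    where
    numerator : + a ℤ.* + d ℤ.+ + c ℤ.* + d ≡ + (a ℕ.* d ℕ.+ c ℕ.* d)
    numerator = sym (trans (pos-+ (a ℕ.* d) (c ℕ.* d)) (cong₂ ℤ._+_ (pos-* a d) (pos-* c d)))
    cross : ∀ a c d → (a ℕ.* d ℕ.+ c ℕ.* d) ℕ.* d ≡ (a ℕ.+ c) ℕ.* (d ℕ.* d)
    cross = solve-∀

  sumTo-cong : ∀ t {f g : ℕ → ℚ} → (∀ a → a ≤ t → f a ≡ g a) → sumTo t f ≡ sumTo t g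
  sumTo-cong zero    f≡g = f≡g 0 ℕ.z≤n
  sumTo-cong (suc t) f≡g =
    cong₂ _+_ (sumTo-cong t (λ a a≤t → f≡g a (ℕ.m≤n⇒m≤1+n a≤t))) (f≡g (suc t) ℕ.≤-refl)

  sumTo-suc : ∀ t (f : ℕ → ℚ) → sumTo (suc t) f ≡ f 0 + sumTo t (f ∘ suc)
  sumTo-suc zero    f = refl
  sumTo-suc (suc t) f = trans (cong (_+ f (suc (suc t))) (sumTo-suc t f)) (+-assoc (f 0) _ _)

  sumTo-distrib-+ : ∀ t (f g : ℕ → ℚ) → sumTo t (λ a → f a + g a) ≡ sumTo t f + sumTo t g
  sumTo-distrib-+ zero    f g = refl
  sumTo-distrib-+ (suc t) f g =
    trans (cong (_+ (f (suc t) + g (suc t))) (sumTo-distrib-+ t f g))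
          (interchange (sumTo t f) (sumTo t g) (f (suc t)) (g (suc t)))

  sumTo-comm : ∀ t r (F : ℕ → ℕ → ℚ) →
               sumTo t (λ a → sumTo r (F a)) ≡ sumTo r (λ l → sumTo t (λ a → F a l))
  sumTo-comm zero    r F = refl
  sumTo-comm (suc t) r F =
    trans (cong (_+ sumTo r (F (suc t))) (sumTo-comm t r F))
          (sym (sumTo-distrib-+ r (λ l → sumTo t (λ a → F a l)) (F (suc t))))

  *-distribˡ-sumTo : ∀ x t (f : ℕ → ℚ) → x * sumTo t f ≡ sumTo t (λ a → x * f a)
  *-distribˡ-sumTo x zero    f = refl
  *-distribˡ-sumTo x (suc t) f =
    trans (*-distribˡ-+ x (sumTo t f) (f (suc t))) (cong (_+ x * f (suc t)) (*-distribˡ-sumTo x t f))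

  *-distribʳ-sumTo : ∀ x t (f : ℕ → ℚ) → sumTo t f * x ≡ sumTo t (λ a → f a * x)
  *-distribʳ-sumTo x zero    f = refl
  *-distribʳ-sumTo x (suc t) f =
    trans (*-distribʳ-+ x (sumTo t f) (f (suc t))) (cong (_+ f (suc t) * x) (*-distribʳ-sumTo x t f))

  sumTo-divℕ : ∀ t (g : ℕ → ℕ) d → sumTo t (λ a → divℕ (g a) d) ≡ divℕ (∑[ i ≤ t ] g (toℕ i)) d
  sumTo-divℕ zero    g d = cong (λ x → divℕ x d) (sym (ℕ.+-identityʳ (g 0)))
  sumTo-divℕ (suc t) g d = begin
    sumTo (suc t) (λ a → divℕ (g a) d)
      ≡⟨ sumTo-suc t (λ a → divℕ (g a) d) ⟩
    divℕ (g 0) d + sumTo t (λ a → divℕ (g (suc a)) d)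
      ≡⟨ cong (λ q → divℕ (g 0) d + q) (sumTo-divℕ t (g ∘ suc) d) ⟩
    divℕ (g 0) d + divℕ (∑[ i ≤ t ] g (suc (toℕ i))) d
      ≡⟨ divℕ-+-divℕ (g 0) (∑[ i ≤ t ] g (suc (toℕ i))) d ⟩
    divℕ (∑[ i ≤ suc t ] g (toℕ i)) d ∎

  hypergeometric : (n t k a : ℕ) → ℚ
  hypergeometric n t k a = divℕ ((k C a) ℕ.* ((n ∸ k) C (t ∸ a))) (n C t)

  normalizedFall : (m l : ℕ) → ℕ → ℚ
  normalizedFall m l x = divℕ (fall x l) (fall m l)

  hahnCoefficient : (r l : ℕ) → ℚ
  hahnCoefficient r l = sgn l * ((+ ((r C l) ℕ.* ((r ℕ.+ l) C l))) ℚ./ 1)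

  T-linear : ∀ n t r (c : ℕ → ℚ) (g : ℕ → ℕ → ℚ) k →
             T n t (λ a → sumTo r (λ l → c l * g l a)) k ≡ sumTo r (λ l → c l * T n t (g l) k)
  T-linear n t r c g k = begin
    sumTo t (λ a → sumTo r (λ l → c l * g l a) * p a)
      ≡⟨ sumTo-cong t (λ a _ → *-distribʳ-sumTo (p a) r (λ l → c l * g l a)) ⟩
    sumTo t (λ a → sumTo r (λ l → c l * g l a * p a))
      ≡⟨ sumTo-comm t r (λ a l → c l * g l a * p a) ⟩
    sumTo r (λ l → sumTo t (λ a → c l * g l a * p a))
      ≡⟨ sumTo-cong r (λ l _ → sumTo-cong t (λ a _ → *-assoc (c l) (g l a) (p a))) ⟩
    sumTo r (λ l → sumTo t (λ a → c l * (g l a * p a)))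
      ≡⟨ sumTo-cong r (λ l _ → *-distribˡ-sumTo (c l) t (λ a → g l a * p a)) ⟨
    sumTo r (λ l → c l * T n t (g l) k) ∎
    where
    p : ℕ → ℚ
    p = hypergeometric n t k

  T-normalizedFall : ∀ {n t k l} → t ≤ n → k ≤ n → l ≤ t →
                     T n t (normalizedFall t l) k ≡ normalizedFall n l k
  T-normalizedFall {n} {t} {k} {l} t≤n k≤n l≤t = begin
    sumTo t (λ a → divℕ (fall a l) (fall t l) * hypergeometric n t k a)
      ≡⟨ sumTo-cong t (λ a _ → divℕ-*-divℕ (fall a l) (fall t l) (w a) (n C t)) ⟩
    sumTo t (λ a → divℕ (fall a l ℕ.* w a) (fall t l ℕ.* (n C t)))
      ≡⟨ sumTo-divℕ t (λ a → fall a l ℕ.* w a) (fall t l ℕ.* (n C t)) ⟩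
    divℕ (factorialMoment l k (n ∸ k) t) (fall t l ℕ.* (n C t))
      ≡⟨ divℕ-cross moment ⟩
    divℕ (fall k l) (fall n l) ∎
    where
    instance
      fall[t,l]*nCt≢0 : NonZero (fall t l ℕ.* (n C t))
      fall[t,l]*nCt≢0 = ℕ.m*n≢0 (fall t l) (n C t) {{fall≢0 l≤t}} {{nCk≢0 t≤n}}
      fall[n,l]≢0 : NonZero (fall n l)
      fall[n,l]≢0 = fall≢0 (ℕ.≤-trans l≤t t≤n)
    w : ℕ → ℕ
    w a = (k C a) ℕ.* ((n ∸ k) C (t ∸ a))
    moment : factorialMoment l k (n ∸ k) t ℕ.* fall n l ≡ fall k l ℕ.* (fall t l ℕ.* (n C t))
    moment = subst (λ N → factorialMoment l k (n ∸ k) t ℕ.* fall N l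
                           ≡ fall k l ℕ.* (fall t l ℕ.* (N C t)))
                   (ℕ.m+[n∸m]≡n k≤n) (factorialMoment-*-fall l k (n ∸ k) t)

lemma4 : (n t r : ℕ) → t ≤ n → r ≤ t →
         (k : ℕ) → k ≤ n → T n t (hahnQ t r) k ≡ hahnQ n r k
lemma4 n t r t≤n r≤t k k≤n = begin
  T n t (hahnQ t r) k
    ≡⟨ T-linear n t r (hahnCoefficient r) (normalizedFall t) k ⟩
  sumTo r (λ l → hahnCoefficient r l ℚ.* T n t (normalizedFall t l) k)
    ≡⟨ sumTo-cong r (λ l l≤r →
         cong (hahnCoefficient r l ℚ.*_) (T-normalizedFall t≤n k≤n (ℕ.≤-trans l≤r r≤t))) ⟩
  hahnQ n r k ∎
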